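{- Let $G$ be a connected graph with $c(G)\ge 1$. Then $$\frac{|\mathscr{T}(G)|}{|\mathscr{H}_1(G)|}\ \ge\ \frac{g(G)}{c(G)}.$$
   Context: All graphs are finite, simple and undirected. For a connected graph $G$ with $n$ vertices and $m$ edges, $c(G)=m-n+1$ is the dimension of its cycle space, $g(G)$ is its girth (length of a shortest cycle), $\mathscr{T}(G)$ is the set of spanning trees of $G$, and $\mathscr{H}_1(G)$ is the set of unicyclic spanning subgraphs of $G$ (connected spanning subgraphs containing exactly one cycle, i.e. with $n$ edges). -}

module Defs where

open import Data.Nat using (ℕ; zero; suc; _+_; _*_; _∸_; _≤_; _<_)
open import Data.Fin using (Fin; toℕ)
open import Data.Fin.Subset using (Subset; _∈_; ⊤; ∣_∣; inside; outside)
open import Data.Vec using (Vec; []; _∷_; lookup)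
open import Data.List using (List; []; _∷_; map; _++_)
open import Data.Product using (Σ; ∃; _×_; _,_)
open import Data.Sum using (_⊎_)
open import Data.Empty using (⊥)
open import Relation.Nullary using (¬_)
open import Relation.Binary.PropositionalEquality using (_≡_)
open import Relation.Binary.Construct.Closure.ReflexiveTransitive using (Star)
open import Function.Definitions using (Injective)

-- A finite simple graph on vertex set Fin n with m edges, given as an
-- edge list: edge k joins (proj₁ (lookup E k)) and (proj₂ (lookup E k)),
-- stored with strictly smaller endpoint first (no loops), and distinct
-- indices give distinct edges (no multiple edges).
record Graph (n m : ℕ) : Set where
  field
    edge     : Fin m → Fin n × Fin n
    ordered  : ∀ k → let (u , v) = edge k in toℕ u < toℕ v
    distinct : Injective _≡_ _≡_ edge

open Graph public

-- A spanning subgraph of G is given by its set of edges (a subset of Fin m).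
-- Adjacency in the spanning subgraph with edge set s.
Adj : ∀ {n m} → Graph n m → Subset m → Fin n → Fin n → Set
Adj G s u v = ∃ λ k → k ∈ s × (edge G k ≡ (u , v) ⊎ edge G k ≡ (v , u))

Connected : ∀ {n m} → Graph n m → Subset m → Set
Connected G s = ∀ u v → Star (Adj G s) u v

Cycle : ∀ {n m} → Graph n m → Subset m → ℕ → Set
Cycle {n} G s k =
  Σ (Fin k → Fin n) λ f →
    Injective _≡_ _≡_ f ×
    3 ≤ k ×
    (∀ i j → (suc (toℕ i) ≡ toℕ j ⊎ (suc (toℕ i) ≡ k × toℕ j ≡ 0)) →
             Adj G s (f i) (f j))

IsSpanningTree : ∀ {n m} → Graph n m → Subset m → Set
IsSpanningTree G s = Connected G s × (∀ k → ¬ Cycle G s k)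

IsUnicyclic : ∀ {n m} → Graph n m → Subset m → Set
IsUnicyclic {n} G s = Connected G s × ∣ s ∣ ≡ n

IsConnectedGraph : ∀ {n m} → Graph n m → Set
IsConnectedGraph G = Connected G ⊤

IsGirth : ∀ {n m} → Graph n m → ℕ → Set
IsGirth G g = Cycle G ⊤ g × (∀ k → Cycle G ⊤ k → g ≤ k)

-- Cyclomatic number c(G) = m - n + 1 (as a natural number; for connected
-- G we have m + 1 ≥ n, so truncated subtraction is exact).
cyc : ∀ {n m} → Graph n m → ℕ
cyc {n} {m} _ = m + 1 ∸ n

allSubsets : (m : ℕ) → List (Subset m)
allSubsets zero = [] ∷ []
allSubsets (suc m) = map (inside ∷_) (allSubsets m) ++ map (outside ∷_) (allSubsets m)

-- Double count the pairs (H, e) with H a unicyclic spanning subgraph, e ∈ H and H − e a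
-- spanning tree. In a connected H with n edges some edge is not among the n − 1 parent edges
-- of a breadth-first tree, so H − e stays connected and e closes a cycle of length ≥ g;
-- deleting any edge of that cycle leaves a connected spanning subgraph with n − 1 edges,
-- i.e. a spanning tree, so each H lies in at least g pairs. A spanning tree T lies in at
-- most m − n + 1 pairs, one for each edge outside T.
module Submission where

open import Defs
import Data.Nat as ℕ
open import Data.Nat using (ℕ; zero; suc; _+_; _*_; _∸_; _≤_; _≰_; _<_; z≤n; s≤s; _<?_; _≤?_)
open import Data.Nat.Properties
open import Data.Bool using (if_then_else_)
open import Data.Fin using (Fin; zero; suc; toℕ; fromℕ<; punchIn; punchOut)
import Data.Fin.Properties as Finₚ
open import Data.Fin.Subset using (Subset; inside; outside; ∣_∣; _∈_; _∉_; _⊆_; _-_; ⁅_⁆)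
open import Data.Fin.Subset.Properties
  using (_∈?_; ∈⊤; p─⊥≡p; p─q⊆p; x∈p∧x≢y⇒x∈p-y; drop-there)
open import Data.Vec using ([]; _∷_; here; there)
open import Data.List using (List; []; _∷_; length; filter; map; _++_)
open import Data.Product using (∃; _×_; _,_; proj₁; proj₂)
open import Data.Sum using (_⊎_; inj₁; inj₂)
import Data.Sum as Sum
open import Data.Product.Properties using (≡-dec)
open import Relation.Binary.Construct.Closure.ReflexiveTransitive
  using (Star; ε; _◅_; _◅◅_; return; reverse; _⋆)
open import Relation.Nullary using (Dec; yes; no; does; ¬_; ¬?)
open import Relation.Nullary.Negation using (contradiction)
open import Relation.Nullary.Decidable using (_×-dec_; _⊎-dec_)
open import Relation.Unary using (Decidable; Pred)
open import Relation.Binary.PropositionalEquality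
open import Function using (_∘_; Injective)
open import Algebra.Properties.CommutativeSemigroup +-commutativeSemigroup
  using () renaming (interchange to +-interchange)

-- Finite sums and counting

-- Defined through `does` so that `𝟙 (yes p ×-dec q)` reduces to `𝟙 q`.
𝟙 : ∀ {p} {P : Set p} → Dec P → ℕ
𝟙 d = if does d then 1 else 0

𝟙-yes : ∀ {p} {P : Set p} (d : Dec P) → P → 𝟙 d ≡ 1
𝟙-yes (yes _) _ = refl
𝟙-yes (no ¬p) p = contradiction p ¬p

𝟙-no : ∀ {p} {P : Set p} (d : Dec P) → ¬ P → 𝟙 d ≡ 0
𝟙-no (yes p) ¬p = contradiction p ¬p
𝟙-no (no _) _ = refl

𝟙-mono-≤ : ∀ {p q} {P : Set p} {Q : Set q} (P? : Dec P) (Q? : Dec Q) → (P → Q) → 𝟙 P? ≤ 𝟙 Q?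
𝟙-mono-≤ (yes p) Q? P⇒Q = ≤-reflexive (sym (𝟙-yes Q? (P⇒Q p)))
𝟙-mono-≤ (no _) Q? P⇒Q = z≤n

sumOver : ∀ {a} {A : Set a} → List A → (A → ℕ) → ℕ
sumOver [] f = 0
sumOver (x ∷ xs) f = f x + sumOver xs f

syntax sumOver xs (λ x → e) = ∑[ x ∈ xs ] e

sumOver-map : ∀ {a b} {A : Set a} {B : Set b} (h : B → A) xs f → sumOver (map h xs) f ≡ sumOver xs (f ∘ h)
sumOver-map h [] f = refl
sumOver-map h (x ∷ xs) f = cong (f (h x) +_) (sumOver-map h xs f)

module _ {a} {A : Set a} where

  sumOver-mono-≤ : ∀ xs {f g : A → ℕ} → (∀ x → f x ≤ g x) → sumOver xs f ≤ sumOver xs g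
  sumOver-mono-≤ [] f≤g = z≤n
  sumOver-mono-≤ (x ∷ xs) f≤g = +-mono-≤ (f≤g x) (sumOver-mono-≤ xs f≤g)

  sumOver-++ : ∀ (xs ys : List A) f → sumOver (xs ++ ys) f ≡ sumOver xs f + sumOver ys f
  sumOver-++ [] ys f = refl
  sumOver-++ (x ∷ xs) ys f = trans (cong (f x +_) (sumOver-++ xs ys f)) (sym (+-assoc (f x) _ _))

  *-distribˡ-sumOver : ∀ c (xs : List A) f → c * sumOver xs f ≡ sumOver xs (λ x → c * f x)
  *-distribˡ-sumOver c [] f = *-zeroʳ c
  *-distribˡ-sumOver c (x ∷ xs) f =
    trans (*-distribˡ-+ c (f x) _) (cong (c * f x +_) (*-distribˡ-sumOver c xs f))

  length-filter≡sumOver-𝟙 : ∀ {p} {P : Pred A p} (P? : Decidable P) xs →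
                            length (filter P? xs) ≡ sumOver xs (𝟙 ∘ P?)
  length-filter≡sumOver-𝟙 P? [] = refl
  length-filter≡sumOver-𝟙 P? (x ∷ xs) with P? x
  ... | yes _ = cong suc (length-filter≡sumOver-𝟙 P? xs)
  ... | no _ = length-filter≡sumOver-𝟙 P? xs

sumFin : ∀ m → (Fin m → ℕ) → ℕ
sumFin zero f = 0
sumFin (suc m) f = f zero + sumFin m (f ∘ suc)

syntax sumFin m (λ i → e) = ∑[ i < m ] e

sumFin-mono-≤ : ∀ m {f g : Fin m → ℕ} → (∀ i → f i ≤ g i) → sumFin m f ≤ sumFin m g
sumFin-mono-≤ zero f≤g = z≤n
sumFin-mono-≤ (suc m) f≤g = +-mono-≤ (f≤g zero) (sumFin-mono-≤ m (f≤g ∘ suc))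

sumFin-zero : ∀ m → ∑[ i < m ] 0 ≡ 0
sumFin-zero zero = refl
sumFin-zero (suc m) = sumFin-zero m

sumFin-distrib-+ : ∀ m (f g : Fin m → ℕ) → ∑[ i < m ] (f i + g i) ≡ sumFin m f + sumFin m g
sumFin-distrib-+ zero f g = refl
sumFin-distrib-+ (suc m) f g =
  trans (cong (f zero + g zero +_) (sumFin-distrib-+ m (f ∘ suc) (g ∘ suc)))
        (+-interchange (f zero) (g zero) _ _)

sumOver-sumFin-comm : ∀ {a} {A : Set a} xs m (F : A → Fin m → ℕ) →
                      ∑[ x ∈ xs ] sumFin m (F x) ≡ ∑[ i < m ] ∑[ x ∈ xs ] F x i
sumOver-sumFin-comm [] m F = sym (sumFin-zero m)
sumOver-sumFin-comm (x ∷ xs) m F =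
  trans (cong (sumFin m (F x) +_) (sumOver-sumFin-comm xs m F)) (sym (sumFin-distrib-+ m (F x) _))

count : ∀ {m p} {P : Pred (Fin m) p} → Decidable P → ℕ
count {m} P? = ∑[ i < m ] 𝟙 (P? i)

count-∈ : ∀ {m} (s : Subset m) → count (_∈? s) ≡ ∣ s ∣
count-∈ [] = refl
count-∈ (inside ∷ s) = cong suc (count-∈ s)
count-∈ (outside ∷ s) = count-∈ s

count-∉+∣s∣ : ∀ {m} (s : Subset m) → count (λ e → ¬? (e ∈? s)) + ∣ s ∣ ≡ m
count-∉+∣s∣ [] = refl
count-∉+∣s∣ (inside ∷ s) = trans (+-suc _ _) (cong suc (count-∉+∣s∣ s))
count-∉+∣s∣ (outside ∷ s) = cong suc (count-∉+∣s∣ s)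

module _ {k m} (h : Fin k → Fin (suc m)) (h≢0 : ∀ i → h i ≢ zero) where

  lowerNonzero : Fin k → Fin m
  lowerNonzero i = punchOut (h≢0 i ∘ sym)

  suc∘lowerNonzero : ∀ i → suc (lowerNonzero i) ≡ h i
  suc∘lowerNonzero i = Finₚ.punchIn-punchOut (h≢0 i ∘ sym)

  lowerNonzero-injective : Injective _≡_ _≡_ h → Injective _≡_ _≡_ lowerNonzero
  lowerNonzero-injective inj {i} {j} eq = inj (Finₚ.punchOut-injective (h≢0 i ∘ sym) (h≢0 j ∘ sym) eq)

injection⇒≤count : ∀ {m k p} {P : Pred (Fin m) p} (P? : Decidable P) (h : Fin k → Fin m) →
                   Injective _≡_ _≡_ h → (∀ i → P (h i)) → k ≤ count P?
injection⇒≤count {k = zero} P? h inj Ph = z≤n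
injection⇒≤count {zero} {suc k} P? h inj Ph with () ← h zero
injection⇒≤count {suc m} {suc k} {P = P} P? h inj Ph with Finₚ.any? (λ j → h j Finₚ.≟ zero)
... | no ∄j = ≤-trans (injection⇒≤count (P? ∘ suc) h′ (lowerNonzero-injective h h≢0 inj) Ph′)
                     (m≤n+m _ (𝟙 (P? zero)))
  where
  h≢0 : ∀ i → h i ≢ zero
  h≢0 i eq = ∄j (i , eq)
  h′ = lowerNonzero h h≢0
  Ph′ : ∀ i → P (suc (h′ i))
  Ph′ i = subst P (sym (suc∘lowerNonzero h h≢0 i)) (Ph i)
... | yes (j , hj≡0) rewrite 𝟙-yes (P? zero) (subst P hj≡0 (Ph j)) =
  s≤s (injection⇒≤count (P? ∘ suc) h′ (lowerNonzero-injective hj hj≢0 hj-injective) Ph′)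
  where
  hj : Fin k → Fin (suc m)
  hj = h ∘ punchIn j
  hj≢0 : ∀ i → hj i ≢ zero
  hj≢0 i eq = Finₚ.punchInᵢ≢i j i (inj (trans eq (sym hj≡0)))
  hj-injective : Injective _≡_ _≡_ hj
  hj-injective eq = Finₚ.punchIn-injective j _ _ (inj eq)
  h′ = lowerNonzero hj hj≢0
  Ph′ : ∀ i → P (suc (h′ i))
  Ph′ i = subst P (sym (suc∘lowerNonzero hj hj≢0 i)) (Ph (punchIn j i))

-- The cover is ℕ-valued so that the induction step can shift it down with `pred`.
count≤cover : ∀ {m k p} {P : Pred (Fin m) p} (P? : Decidable P) (h : Fin k → ℕ) →
              (∀ e → P e → ∃ λ i → h i ≡ toℕ e) → count P? ≤ k
count≤cover {zero} P? h cover = z≤n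
count≤cover {suc m} {P = P} P? h cover with P? zero
... | no _ = count≤cover (P? ∘ suc) (ℕ.pred ∘ h) cover′
  where
  cover′ : ∀ e → P (suc e) → ∃ λ i → ℕ.pred (h i) ≡ toℕ e
  cover′ e Pe with i , hi ← cover (suc e) Pe = i , cong ℕ.pred hi
... | yes P0 with j , hj≡0 ← cover zero P0 = skipPreimageOf0 h cover j hj≡0
  where
  skipPreimageOf0 : ∀ {k} (h : Fin k → ℕ) → (∀ e → P e → ∃ λ i → h i ≡ toℕ e) →
                    ∀ j → h j ≡ 0 → suc (count (P? ∘ suc)) ≤ k
  skipPreimageOf0 {suc k} h cover j hj≡0 =
    s≤s (count≤cover (P? ∘ suc) (ℕ.pred ∘ h ∘ punchIn j) cover′)
    where
    cover′ : ∀ e → P (suc e) → ∃ λ i → ℕ.pred (h (punchIn j i)) ≡ toℕ e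
    cover′ e Pe with i , hi ← cover (suc e) Pe = punchOut j≢i , cong ℕ.pred hi′
      where
      j≢i : j ≢ i
      j≢i refl = 0≢1+n (trans (sym hj≡0) hi)
      hi′ : h (punchIn j (punchOut j≢i)) ≡ suc (toℕ e)
      hi′ = trans (cong h (Finₚ.punchIn-punchOut j≢i)) hi

-- Double counting over subsets

x∉p-x : ∀ {m} (p : Subset m) x → x ∉ p - x
x∉p-x (s ∷ p) zero ()
x∉p-x (s ∷ p) (suc x) (there x∈p-x) = x∉p-x p x x∈p-x

x∈p⇒suc∣p-x∣≡∣p∣ : ∀ {m} {p : Subset m} {x} → x ∈ p → suc ∣ p - x ∣ ≡ ∣ p ∣
x∈p⇒suc∣p-x∣≡∣p∣ {p = inside ∷ p} here = cong (suc ∘ ∣_∣) (p─⊥≡p p)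
x∈p⇒suc∣p-x∣≡∣p∣ {p = inside ∷ p} (there x∈p) = cong suc (x∈p⇒suc∣p-x∣≡∣p∣ x∈p)
x∈p⇒suc∣p-x∣≡∣p∣ {p = outside ∷ p} (there x∈p) = x∈p⇒suc∣p-x∣≡∣p∣ x∈p

sumOver-allSubsets : ∀ m (F : Subset (suc m) → ℕ) →
  ∑[ s ∈ allSubsets (suc m) ] F s ≡
  ∑[ s ∈ allSubsets m ] F (inside ∷ s) + ∑[ s ∈ allSubsets m ] F (outside ∷ s)
sumOver-allSubsets m F = begin
  sumOver (map (inside ∷_) A ++ map (outside ∷_) A) F
    ≡⟨ sumOver-++ (map (inside ∷_) A) _ F ⟩
  sumOver (map (inside ∷_) A) F + sumOver (map (outside ∷_) A) F
    ≡⟨ cong₂ _+_ (sumOver-map (inside ∷_) A F) (sumOver-map (outside ∷_) A F) ⟩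
  sumOver A (F ∘ (inside ∷_)) + sumOver A (F ∘ (outside ∷_)) ∎
  where
  open ≡-Reasoning
  A = allSubsets m

-- s ↦ s - e maps the subsets containing e injectively to subsets avoiding e.
sumOver-allSubsets-removal-≤ : ∀ {m} e (F G : Subset m → ℕ) →
  (∀ s → e ∉ s → F s ≡ 0) → (∀ s → e ∈ s → F s ≤ G (s - e)) →
  ∑[ s ∈ allSubsets m ] F s ≤ ∑[ s ∈ allSubsets m ] G s
sumOver-allSubsets-removal-≤ {suc m} zero F G F≡0 F≤G = begin
  sumOver (allSubsets (suc m)) F
    ≡⟨ sumOver-allSubsets m F ⟩
  sumOver A (F ∘ (inside ∷_)) + sumOver A (F ∘ (outside ∷_))
    ≤⟨ +-mono-≤ (sumOver-mono-≤ A F-in≤G-out) (sumOver-mono-≤ A F-out≤G-in) ⟩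
  sumOver A (G ∘ (outside ∷_)) + sumOver A (G ∘ (inside ∷_))
    ≡⟨ +-comm (sumOver A (G ∘ (outside ∷_))) _ ⟩
  sumOver A (G ∘ (inside ∷_)) + sumOver A (G ∘ (outside ∷_))
    ≡⟨ sumOver-allSubsets m G ⟨
  sumOver (allSubsets (suc m)) G ∎
  where
  open ≤-Reasoning
  A = allSubsets m
  F-in≤G-out : ∀ s → F (inside ∷ s) ≤ G (outside ∷ s)
  F-in≤G-out s = subst (λ t → F (inside ∷ s) ≤ G (outside ∷ t)) (p─⊥≡p s) (F≤G _ here)
  F-out≤G-in : ∀ s → F (outside ∷ s) ≤ G (inside ∷ s)
  F-out≤G-in s = subst (_≤ _) (sym (F≡0 _ λ ())) z≤n
sumOver-allSubsets-removal-≤ {suc m} (suc e) F G F≡0 F≤G = begin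
  sumOver (allSubsets (suc m)) F
    ≡⟨ sumOver-allSubsets m F ⟩
  sumOver A (F ∘ (inside ∷_)) + sumOver A (F ∘ (outside ∷_))
    ≤⟨ +-mono-≤ (sumOver-allSubsets-removal-≤ e _ _ (λ _ e∉s → F≡0 _ (e∉s ∘ drop-there)) (λ _ → F≤G _ ∘ there))
                (sumOver-allSubsets-removal-≤ e _ _ (λ _ e∉s → F≡0 _ (e∉s ∘ drop-there)) (λ _ → F≤G _ ∘ there)) ⟩
  sumOver A (G ∘ (inside ∷_)) + sumOver A (G ∘ (outside ∷_))
    ≡⟨ sumOver-allSubsets m G ⟨
  sumOver (allSubsets (suc m)) G ∎
  where
  open ≤-Reasoning
  A = allSubsets m

double-counting : ∀ {m h t} {H : Pred (Subset m) h} {T : Pred (Subset m) t}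
  (H? : Decidable H) (T? : Decidable T) (a b : ℕ) →
  (∀ s → H s → a ≤ count (λ e → e ∈? s ×-dec T? (s - e))) →
  (∀ t → T t → count (λ e → ¬? (e ∈? t)) ≤ b) →
  a * length (filter H? (allSubsets m)) ≤ b * length (filter T? (allSubsets m))
double-counting {m} H? T? a b a≤ ≤b = begin
  a * length (filter H? A)
    ≡⟨ cong (a *_) (length-filter≡sumOver-𝟙 H? A) ⟩
  a * (∑[ s ∈ A ] 𝟙 (H? s))
    ≡⟨ *-distribˡ-sumOver a A _ ⟩
  ∑[ s ∈ A ] (a * 𝟙 (H? s))
    ≤⟨ sumOver-mono-≤ A a*𝟙H≤ ⟩
  ∑[ s ∈ A ] ∑[ e < m ] 𝟙 (Removal? s e)
    ≡⟨ sumOver-sumFin-comm A m _ ⟩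
  ∑[ e < m ] ∑[ s ∈ A ] 𝟙 (Removal? s e)
    ≤⟨ sumFin-mono-≤ m (λ e → sumOver-allSubsets-removal-≤ e _ _
                                (λ s e∉s → 𝟙-no (Removal? s e) (e∉s ∘ proj₁ ∘ proj₂))
                                (λ s _ → 𝟙-mono-≤ (Removal? s e) (Missing? (s - e) e)
                                                   (λ (_ , _ , τ) → τ , x∉p-x s e))) ⟩
  ∑[ e < m ] ∑[ t ∈ A ] 𝟙 (Missing? t e)
    ≡⟨ sumOver-sumFin-comm A m _ ⟨
  ∑[ t ∈ A ] ∑[ e < m ] 𝟙 (Missing? t e)
    ≤⟨ sumOver-mono-≤ A ≤b*𝟙T ⟩
  ∑[ t ∈ A ] (b * 𝟙 (T? t))
    ≡⟨ *-distribˡ-sumOver b A _ ⟨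
  b * (∑[ t ∈ A ] 𝟙 (T? t))
    ≡⟨ cong (b *_) (length-filter≡sumOver-𝟙 T? A) ⟨
  b * length (filter T? A) ∎
  where
  open ≤-Reasoning
  A = allSubsets m
  Removal? : ∀ s e → Dec _
  Removal? s e = H? s ×-dec (e ∈? s ×-dec T? (s - e))
  Missing? : ∀ t e → Dec _
  Missing? t e = T? t ×-dec ¬? (e ∈? t)

  a*𝟙H≤ : ∀ s → a * 𝟙 (H? s) ≤ ∑[ e < m ] 𝟙 (Removal? s e)
  a*𝟙H≤ s with H? s
  ... | yes η = ≤-trans (≤-reflexive (*-identityʳ a)) (a≤ s η)
  ... | no _ = ≤-trans (≤-reflexive (*-zeroʳ a)) z≤n

  ≤b*𝟙T : ∀ t → ∑[ e < m ] 𝟙 (Missing? t e) ≤ b * 𝟙 (T? t)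
  ≤b*𝟙T t with T? t
  ... | yes τ = ≤-trans (≤b t τ) (≤-reflexive (sym (*-identityʳ b)))
  ... | no _ = ≤-trans (≤-reflexive (sumFin-zero m)) z≤n

-- Graphs and breadth-first search

minimal : ∀ {p} {P : Pred ℕ p} → Decidable P → ∀ {l} → P l →
          ∃ λ d → P d × (∀ {d′} → P d′ → d ≤ d′)
minimal P? Pl with P? 0
... | yes P0 = 0 , P0 , λ _ → z≤n
minimal P? {zero} Pl | no ¬P0 = contradiction Pl ¬P0
minimal P? {suc l} Pl | no ¬P0 with d , Pd , d-min ← minimal (P? ∘ suc) Pl =
  suc d , Pd , λ { {zero} P0 → contradiction P0 ¬P0 ; {suc d′} Pd′ → s≤s (d-min Pd′) }

Star-chain : ∀ {i t} {I : Set i} {T : I → I → Set t} (f : ℕ → I) {a b} →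
             (∀ {j} → a ≤ j → j < b → T (f j) (f (suc j))) → a ≤ b → Star T (f a) (f b)
Star-chain f {a} step a≤b = go (≤⇒≤′ a≤b) step
  where
  go : ∀ {b} → a ℕ.≤′ b → (∀ {j} → a ≤ j → j < b → _) → Star _ (f a) (f b)
  go ℕ.≤′-refl step = ε
  go (ℕ.≤′-step a≤′b) step =
    go a≤′b (λ a≤j j<b → step a≤j (m<n⇒m<1+n j<b)) ◅◅ return (step (≤′⇒≤ a≤′b) ≤-refl)

≡-unordered : ∀ {A : Set} {x : A × A} {a b c d : A} →
              x ≡ (a , b) ⊎ x ≡ (b , a) → x ≡ (c , d) ⊎ x ≡ (d , c) →
              (a ≡ c × b ≡ d) ⊎ (a ≡ d × b ≡ c)
≡-unordered (inj₁ refl) (inj₁ refl) = inj₁ (refl , refl)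
≡-unordered (inj₁ refl) (inj₂ refl) = inj₂ (refl , refl)
≡-unordered (inj₂ refl) (inj₁ refl) = inj₂ (refl , refl)
≡-unordered (inj₂ refl) (inj₂ refl) = inj₁ (refl , refl)

Joins : ∀ {n m} → Graph n m → Fin m → Fin n → Fin n → Set
Joins G k u v = edge G k ≡ (u , v) ⊎ edge G k ≡ (v , u)

module _ {n m} (G : Graph n m) where

  Adj? : ∀ s → (u v : Fin n) → Dec (Adj G s u v)
  Adj? s u v = Finₚ.any? λ k → k ∈? s ×-dec (edge G k ≟² (u , v) ⊎-dec edge G k ≟² (v , u))
    where _≟²_ = ≡-dec Finₚ._≟_ Finₚ._≟_

  Adj-sym : ∀ {s u v} → Adj G s u v → Adj G s v u
  Adj-sym (k , k∈s , joins) = k , k∈s , Sum.swap joins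

  Adj-mono : ∀ {s s′ u v} → s ⊆ s′ → Adj G s u v → Adj G s′ u v
  Adj-mono s⊆s′ (k , k∈s , joins) = k , s⊆s′ k∈s , joins

  Adj-remove : ∀ {s u v} e (a : Adj G s u v) → proj₁ a ≢ e → Adj G (s - e) u v
  Adj-remove e (k , k∈s , joins) k≢e = k , x∈p∧x≢y⇒x∈p-y k∈s k≢e , joins

  Adj-unremove : ∀ {s u v} e → Adj G (s - e) u v → Adj G s u v
  Adj-unremove {s} e = Adj-mono (p─q⊆p s ⁅ e ⁆)

  Adj⋆-sym : ∀ {s u v} → Star (Adj G s) u v → Star (Adj G s) v u
  Adj⋆-sym = reverse Adj-sym

  edge-ordered : ∀ k {u v} → edge G k ≡ (u , v) → toℕ u < toℕ v
  edge-ordered k refl = ordered G k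

  edge-unique : ∀ {k k′ u v} → Joins G k u v → Joins G k′ u v → k ≡ k′
  edge-unique (inj₁ p) (inj₁ q) = distinct G (trans p (sym q))
  edge-unique {k} {k′} (inj₁ p) (inj₂ q) = contradiction (edge-ordered k′ q) (<-asym (edge-ordered k p))
  edge-unique {k} {k′} (inj₂ p) (inj₁ q) = contradiction (edge-ordered k′ q) (<-asym (edge-ordered k p))
  edge-unique (inj₂ p) (inj₂ q) = distinct G (trans p (sym q))

  cycle-mono : ∀ {s s′ k} → s ⊆ s′ → Cycle G s k → Cycle G s′ k
  cycle-mono s⊆s′ (f , f-inj , 3≤k , adjacent) =
    f , f-inj , 3≤k , λ i j consecutive → Adj-mono s⊆s′ (adjacent i j consecutive)

module BreadthFirst {n} {A : Fin n → Fin n → Set} (A? : ∀ u v → Dec (A u v))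
                    (root : Fin n) (reach : ∀ v → Star A root v) where

  Within : ℕ → Fin n → Set
  Within zero v = v ≡ root
  Within (suc l) v = Within l v ⊎ ∃ λ u → Within l u × A u v

  Within? : ∀ l v → Dec (Within l v)
  Within? zero v = v Finₚ.≟ root
  Within? (suc l) v = Within? l v ⊎-dec Finₚ.any? (λ u → Within? l u ×-dec A? u v)

  Within-◅◅ : ∀ {l u v} → Within l u → Star A u v → ∃ λ l′ → Within l′ v
  Within-◅◅ {l} w ε = l , w
  Within-◅◅ w (x ◅ xs) = Within-◅◅ (inj₂ (_ , w , x)) xs

  private
    shortest : ∀ v → ∃ λ d → Within d v × (∀ {d′} → Within d′ v → d ≤ d′)
    shortest v = minimal (λ l → Within? l v) (proj₂ (Within-◅◅ {0} refl (reach v)))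

  dist : Fin n → ℕ
  dist v = proj₁ (shortest v)

  Within-dist : ∀ v → Within (dist v) v
  Within-dist v = proj₁ (proj₂ (shortest v))

  dist-minimal : ∀ {l v} → Within l v → dist v ≤ l
  dist-minimal {v = v} = proj₂ (proj₂ (shortest v))

  dist-root : dist root ≡ 0
  dist-root = n≤0⇒n≡0 (dist-minimal {0} refl)

  dist≡0⇒≡root : ∀ {v} → dist v ≡ 0 → v ≡ root
  dist≡0⇒≡root {v} eq = subst (λ l → Within l v) eq (Within-dist v)

  ≢root⇒∃parent : ∀ {v} → v ≢ root → ∃ λ u → A u v × suc (dist u) ≡ dist v
  ≢root⇒∃parent {v} v≢root with dist v | Within-dist v | (λ l → dist-minimal {l} {v})
  ... | zero | v≡root | _ = contradiction v≡root v≢root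
  ... | suc d | inj₁ within-d | d+1-min = contradiction (d+1-min d within-d) 1+n≰n
  ... | suc d | inj₂ (u , within-u , uv) | d+1-min =
    u , uv , cong suc (≤-antisym (dist-minimal within-u) d≤dist-u)
    where
    d≤dist-u : d ≤ dist u
    d≤dist-u = ≤-pred (d+1-min _ (inj₂ (u , Within-dist u , uv)))

  -- Not defined by `with v ≟ root`: that test also occurs inside `dist v` (as `Within? 0 v`).
  private
    parentBy : ∀ v → Dec (v ≡ root) → Fin n
    parentBy v (yes _) = v
    parentBy v (no v≢root) = proj₁ (≢root⇒∃parent v≢root)

    parentBy-spec : ∀ {v} (v≟root : Dec (v ≡ root)) → v ≢ root →
                    A (parentBy v v≟root) v × suc (dist (parentBy v v≟root)) ≡ dist v
    parentBy-spec (yes v≡root) v≢root = contradiction v≡root v≢root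
    parentBy-spec (no v≢root) _ = proj₂ (≢root⇒∃parent v≢root)

  parent : Fin n → Fin n
  parent v = parentBy v (v Finₚ.≟ root)

  parent-spec : ∀ {v} → v ≢ root → A (parent v) v × suc (dist (parent v)) ≡ dist v
  parent-spec {v} = parentBy-spec (v Finₚ.≟ root)

module SpanningBreadthFirst {n m} (G : Graph (suc n) m) (s : Subset m) (conn : Connected G s) where
  open BreadthFirst (Adj? G s) zero (conn zero)

  parentAdj : (i : Fin n) → Adj G s (parent (suc i)) (suc i)
  parentAdj i = proj₁ (parent-spec {suc i} λ ())

  parentEdge : Fin n → Fin m
  parentEdge i = proj₁ (parentAdj i)

  parentEdge-∈ : ∀ i → parentEdge i ∈ s
  parentEdge-∈ i = proj₁ (proj₂ (parentAdj i))

  parentEdge-joins : ∀ i → Joins G (parentEdge i) (parent (suc i)) (suc i)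
  parentEdge-joins i = proj₂ (proj₂ (parentAdj i))

  dist-parent : ∀ i → suc (dist (parent (suc i))) ≡ dist (suc i)
  dist-parent i = proj₂ (parent-spec {suc i} λ ())

  parentEdge-injective : Injective _≡_ _≡_ parentEdge
  parentEdge-injective {i} {j} eq
    with ≡-unordered (parentEdge-joins i)
                     (subst (λ k → Joins G k (parent (suc j)) (suc j)) (sym eq) (parentEdge-joins j))
  ... | inj₁ (_ , i≡j) = Finₚ.suc-injective i≡j
  ... | inj₂ (p-i≡j , i≡p-j) = contradiction (m<n+m (dist (suc i)) (s≤s z≤n)) (<-irrefl (sym dist-cycle))
    where
    dist-cycle : suc (suc (dist (suc i))) ≡ dist (suc i)
    dist-cycle = begin
      suc (suc (dist (suc i)))            ≡⟨ cong (λ v → suc (suc (dist v))) i≡p-j ⟩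
      suc (suc (dist (parent (suc j))))   ≡⟨ cong suc (dist-parent j) ⟩
      suc (dist (suc j))                  ≡⟨ cong (λ v → suc (dist v)) p-i≡j ⟨
      suc (dist (parent (suc i)))         ≡⟨ dist-parent i ⟩
      dist (suc i)                        ∎
      where open ≡-Reasoning

  n≤∣s∣ : n ≤ ∣ s ∣
  n≤∣s∣ = subst (n ≤_) (count-∈ s)
                (injection⇒≤count (_∈? s) parentEdge parentEdge-injective parentEdge-∈)

  minus-nonParentEdge-connected : ∀ e → (∀ i → parentEdge i ≢ e) → Connected G (s - e)
  minus-nonParentEdge-connected e ≢e u v = toRoot u refl ◅◅ Adj⋆-sym G (toRoot v refl)
    where
    toRoot : ∀ {d} v → dist v ≡ d → Star (Adj G (s - e)) v zero
    toRoot {zero} v dist≡0 = subst (λ v → Star _ v zero) (sym (dist≡0⇒≡root dist≡0)) ε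
    toRoot {suc d} zero dist≡suc = contradiction (trans (sym dist-root) dist≡suc) 0≢1+n
    toRoot {suc d} (suc i) dist≡suc =
      Adj-sym G (Adj-remove G e (parentAdj i) (≢e i))
        ◅ toRoot (parent (suc i)) (suc-injective (trans (dist-parent i) dist≡suc))

  ∃-removableEdge : ∣ s ∣ ≡ suc n → ∃ λ e → e ∈ s × Connected G (s - e)
  ∃-removableEdge ∣s∣≡n+1
    with Finₚ.any? (λ e → e ∈? s ×-dec Finₚ.all? (λ i → ¬? (parentEdge i Finₚ.≟ e)))
  ... | yes (e , e∈s , ≢e) = e , e∈s , minus-nonParentEdge-connected e ≢e
  ... | no ∄e = contradiction n+1≤n 1+n≰n
    where
    cover : ∀ e → e ∈ s → ∃ λ i → toℕ (parentEdge i) ≡ toℕ e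
    cover e e∈s with Finₚ.any? (λ i → parentEdge i Finₚ.≟ e)
    ... | yes (i , ≡e) = i , cong toℕ ≡e
    ... | no ∄i = contradiction (e , e∈s , λ i ≡e → ∄i (i , ≡e)) ∄e
    n+1≤n : suc n ≤ n
    n+1≤n = subst (_≤ n) (trans (count-∈ s) ∣s∣≡n+1) (count≤cover (_∈? s) (toℕ ∘ parentEdge) cover)

connected⇒n≤suc∣s∣ : ∀ {n m} (G : Graph n m) {s} → Connected G s → n ≤ suc ∣ s ∣
connected⇒n≤suc∣s∣ {zero} G conn = z≤n
connected⇒n≤suc∣s∣ {suc n} G {s} conn = s≤s (SpanningBreadthFirst.n≤∣s∣ G s conn)

-- Cycles

module CycleEdges {n m} (G : Graph n m) {s k} (C : Cycle G s k) where
  private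
    3≤k : 3 ≤ k
    3≤k = proj₁ (proj₂ (proj₂ C))

  0<k : 0 < k
  0<k = ≤-trans (s≤s z≤n) 3≤k

  private
    1<k : 1 < k
    1<k = ≤-trans (s≤s (s≤s z≤n)) 3≤k

    k≢2 : k ≢ 2
    k≢2 k≡2 = contradiction (subst (3 ≤_) k≡2 3≤k) λ { (s≤s (s≤s ())) }

    last : ∀ {t} → t < k → ¬ suc t < k → suc t ≡ k
    last t<k t+1≮k = ≤-antisym t<k (≮⇒≥ t+1≮k)

  -- Positions t ≥ k are junk (sent to 0); every lemma assumes t < k.
  position : ℕ → Fin k
  position t with t <? k
  ... | yes t<k = fromℕ< t<k
  ... | no _ = fromℕ< 0<k

  toℕ-position : ∀ {t} → t < k → toℕ (position t) ≡ t
  toℕ-position {t} t<k with t <? k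
  ... | yes t<k′ = Finₚ.toℕ-fromℕ< t<k′
  ... | no t≮k = contradiction t<k t≮k

  vertex : ℕ → Fin n
  vertex = proj₁ C ∘ position

  vertex-injective : ∀ {t t′} → t < k → t′ < k → vertex t ≡ vertex t′ → t ≡ t′
  vertex-injective {t} {t′} t<k t′<k eq = begin
    t                    ≡⟨ toℕ-position t<k ⟨
    toℕ (position t)     ≡⟨ cong toℕ (proj₁ (proj₂ C) eq) ⟩
    toℕ (position t′)    ≡⟨ toℕ-position t′<k ⟩
    t′                   ∎
    where open ≡-Reasoning

  next : ℕ → ℕ
  next t with suc t <? k
  ... | yes _ = suc t
  ... | no _ = 0

  next-suc : ∀ {t} → suc t < k → next t ≡ suc t
  next-suc {t} t+1<k with suc t <? k
  ... | yes _ = refl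
  ... | no t+1≮k = contradiction t+1<k t+1≮k

  next-last : ∀ {t} → suc t ≡ k → next t ≡ 0
  next-last {t} t+1≡k with suc t <? k
  ... | yes t+1<k = contradiction t+1≡k (<⇒≢ t+1<k)
  ... | no _ = refl

  next<k : ∀ {t} → t < k → next t < k
  next<k {t} t<k with suc t <? k
  ... | yes t+1<k = t+1<k
  ... | no _ = 0<k

  next∘next≢id : ∀ {t} → t < k → next (next t) ≢ t
  next∘next≢id {t} t<k with suc t <? k
  ... | no t+1≮k = λ eq → k≢2 (trans (sym (last t<k t+1≮k)) (cong suc (trans (sym eq) (next-suc 1<k))))
  ... | yes t+1<k with suc (suc t) <? k
  ...   | yes _ = λ eq → contradiction (m<n+m t (s≤s z≤n)) (<-irrefl (sym eq))
  ...   | no t+2≮k = λ eq → k≢2 (trans (sym (last t+1<k t+2≮k)) (cong (λ x → suc (suc x)) (sym eq)))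

  step : ∀ {t} → t < k → Adj G s (vertex t) (vertex (next t))
  step {t} t<k with suc t <? k
  ... | yes t+1<k = proj₂ (proj₂ (proj₂ C)) _ _
    (inj₁ (trans (cong suc (toℕ-position t<k)) (sym (toℕ-position t+1<k))))
  ... | no t+1≮k = proj₂ (proj₂ (proj₂ C)) _ _
    (inj₂ (trans (cong suc (toℕ-position t<k)) (last t<k t+1≮k) , toℕ-position 0<k))

  edgeAt : ∀ {t} → t < k → Fin m
  edgeAt t<k = proj₁ (step t<k)

  edgeAt-∈ : ∀ {t} (t<k : t < k) → edgeAt t<k ∈ s
  edgeAt-∈ t<k = proj₁ (proj₂ (step t<k))

  edgeAt-joins : ∀ {t} (t<k : t < k) → Joins G (edgeAt t<k) (vertex t) (vertex (next t))
  edgeAt-joins t<k = proj₂ (proj₂ (step t<k))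

  edgeAt-injective : ∀ {t t′} (t<k : t < k) (t′<k : t′ < k) → edgeAt t<k ≡ edgeAt t′<k → t ≡ t′
  edgeAt-injective {t} {t′} t<k t′<k eq
    with ≡-unordered (edgeAt-joins t<k)
                     (subst (λ e → Joins G e (vertex t′) (vertex (next t′))) (sym eq) (edgeAt-joins t′<k))
  ... | inj₁ (vt≡vt′ , _) = vertex-injective t<k t′<k vt≡vt′
  ... | inj₂ (vt≡vnt′ , vnt≡vt′) = contradiction
    (trans (cong next (sym (vertex-injective t<k (next<k t′<k) vt≡vnt′)))
           (vertex-injective (next<k t<k) t′<k vnt≡vt′))
    (next∘next≢id t′<k)

  module _ (conn : Connected G s) {i} (i<k : i < k) where
    private
      e = edgeAt i<k

      stepAvoiding : ∀ {t} (t<k : t < k) → t ≢ i → Adj G (s - e) (vertex t) (vertex (next t))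
      stepAvoiding t<k t≢i = Adj-remove G e (step t<k) (t≢i ∘ edgeAt-injective t<k i<k)

      forward : ∀ {t} → suc t < k → t ≢ i → Adj G (s - e) (vertex t) (vertex (suc t))
      forward {t} t+1<k t≢i =
        subst (Adj G (s - e) (vertex t) ∘ vertex) (next-suc t+1<k) (stepAvoiding (<-trans (n<1+n t) t+1<k) t≢i)

      last-index = ℕ.pred k

      suc-last-index : suc last-index ≡ k
      suc-last-index = suc-pred k {{ℕ.>-nonZero 0<k}}

      -- Below i walk down to 0; above i walk up to k − 1 and take the closing edge to 0.
      toStart : ∀ {t} → t < k → Star (Adj G (s - e)) (vertex t) (vertex 0)
      toStart {t} t<k with t ≤? i
      ... | yes t≤i = Adj⋆-sym G (Star-chain vertex (λ _ j<t → forward′ (≤-trans j<t t≤i)) z≤n)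
        where
        forward′ : ∀ {j} → j < i → Adj G (s - e) (vertex j) (vertex (suc j))
        forward′ j<i = forward (≤-<-trans j<i i<k) (<⇒≢ j<i)
      ... | no t≰i = Star-chain vertex (λ t≤j j<last → forward′ (<-≤-trans i<t t≤j) j<last) t≤last
                     ◅◅ return closing
        where
        i<t : i < t
        i<t = ≰⇒> t≰i
        t≤last : t ≤ last-index
        t≤last = ≤-pred (subst (t <_) (sym suc-last-index) t<k)
        forward′ : ∀ {j} → i < j → j < last-index → Adj G (s - e) (vertex j) (vertex (suc j))
        forward′ i<j j<last = forward (subst (_ <_) suc-last-index (s≤s j<last)) (>⇒≢ i<j)
        closing : Adj G (s - e) (vertex last-index) (vertex 0)
        closing = subst (Adj G (s - e) (vertex last-index) ∘ vertex) (next-last suc-last-index)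
                        (stepAvoiding (subst (last-index <_) suc-last-index ≤-refl)
                                      (>⇒≢ (<-≤-trans i<t t≤last)))

      around : Star (Adj G (s - e)) (vertex i) (vertex (next i))
      around = toStart i<k ◅◅ Adj⋆-sym G (toStart (next<k i<k))

      -- A use of the removed edge is replaced by a walk around the rest of the cycle.
      reconnect : ∀ {u v} → Adj G s u v → Star (Adj G (s - e)) u v
      reconnect a@(k′ , _ , joins) with k′ Finₚ.≟ e
      ... | no k′≢e = return (Adj-remove G e a k′≢e)
      ... | yes refl with ≡-unordered joins (edgeAt-joins i<k)
      ...   | inj₁ (refl , refl) = around
      ...   | inj₂ (refl , refl) = Adj⋆-sym G around

    minus-edgeAt-connected : Connected G (s - edgeAt i<k)
    minus-edgeAt-connected u v = (reconnect ⋆) (conn u v)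

connected⇒acyclic : ∀ {n m} (G : Graph n m) {s} → Connected G s → suc ∣ s ∣ ≡ n →
                    ∀ k → ¬ Cycle G s k
connected⇒acyclic {n} G {s} conn ∣s∣+1≡n k C =
  contradiction n≤∣s∣ (subst (_≰ ∣ s ∣) ∣s∣+1≡n 1+n≰n)
  where
  open CycleEdges G C
  n≤∣s∣ : n ≤ ∣ s ∣
  n≤∣s∣ = subst (n ≤_) (x∈p⇒suc∣p-x∣≡∣p∣ (edgeAt-∈ 0<k))
                (connected⇒n≤suc∣s∣ G (minus-edgeAt-connected conn 0<k))

unicyclic-minus-cycleEdge-isSpanningTree : ∀ {n m} (G : Graph n m) {s} → IsUnicyclic G s →
  ∀ {k} (C : Cycle G s k) {i} (i<k : i < k) → IsSpanningTree G (s - CycleEdges.edgeAt G C i<k)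
unicyclic-minus-cycleEdge-isSpanningTree G (conn , ∣s∣≡n) C i<k =
  conn′ , connected⇒acyclic G conn′ (trans (x∈p⇒suc∣p-x∣≡∣p∣ (edgeAt-∈ i<k)) ∣s∣≡n)
  where
  open CycleEdges G C
  conn′ = minus-edgeAt-connected conn i<k

module CycleThroughEdge {n m} (G : Graph n m) {s e} (e∈s : e ∈ s) (conn : Connected G (s - e)) where
  private
    a b : Fin n
    a = proj₁ (edge G e)
    b = proj₂ (edge G e)

  open BreadthFirst (Adj? G (s - e)) a (conn a)

  d : ℕ
  d = dist b

  ancestor : ℕ → Fin n
  ancestor zero = b
  ancestor (suc t) = parent (ancestor t)

  dist-ancestor : ∀ {t} → t ≤ d → dist (ancestor t) + t ≡ d
  dist-ancestor {zero} _ = +-identityʳ d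
  dist-ancestor {suc t} t+1≤d = begin
    dist (parent (ancestor t)) + suc t      ≡⟨ +-suc _ t ⟩
    suc (dist (parent (ancestor t))) + t    ≡⟨ cong (_+ t) (proj₂ (parent-spec ancestor≢a)) ⟩
    dist (ancestor t) + t                   ≡⟨ IH ⟩
    d                                       ∎
    where
    open ≡-Reasoning
    IH = dist-ancestor (≤-trans (n≤1+n t) t+1≤d)
    ancestor≢a : ancestor t ≢ a
    ancestor≢a eq = <⇒≢ t+1≤d (trans (cong (_+ t) (sym (trans (cong dist eq) dist-root))) IH)

  -- The breadth-first path from a to b in s - e, indexed by distance from a; e closes it.
  vertex : Fin (suc d) → Fin n
  vertex j = ancestor (d ∸ toℕ j)

  dist-vertex : ∀ j → dist (vertex j) ≡ toℕ j
  dist-vertex j = +-cancelʳ-≡ (d ∸ toℕ j) _ _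
    (trans (dist-ancestor (m∸n≤m d (toℕ j))) (sym (m+[n∸m]≡n (≤-pred (Finₚ.toℕ<n j)))))

  vertex-injective : Injective _≡_ _≡_ vertex
  vertex-injective {i} {j} eq =
    Finₚ.toℕ-injective (trans (sym (dist-vertex i)) (trans (cong dist eq) (dist-vertex j)))

  b≢a : b ≢ a
  b≢a b≡a = <-irrefl (cong toℕ (sym b≡a)) (edge-ordered G e refl)

  d≢0 : d ≢ 0
  d≢0 = b≢a ∘ dist≡0⇒≡root

  d≢1 : d ≢ 1
  d≢1 d≡1 = e∉s-e (edge-unique G (proj₂ (proj₂ adj-ab)) (inj₁ refl))
    where
    parent-b≡a = dist≡0⇒≡root (suc-injective (trans (proj₂ (parent-spec b≢a)) d≡1))
    adj-ab : Adj G (s - e) a b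
    adj-ab = subst (λ u → Adj G (s - e) u b) parent-b≡a (proj₁ (parent-spec b≢a))
    e∉s-e : proj₁ adj-ab ≢ e
    e∉s-e eq = x∉p-x s e (subst (_∈ s - e) eq (proj₁ (proj₂ adj-ab)))

  3≤d+1 : 3 ≤ suc d
  3≤d+1 with d | d≢0 | d≢1
  ... | zero | d≢0 | _ = contradiction refl d≢0
  ... | suc zero | _ | d≢1 = contradiction refl d≢1
  ... | suc (suc _) | _ | _ = s≤s (s≤s (s≤s z≤n))

  adjacent : ∀ i j → suc (toℕ i) ≡ toℕ j ⊎ (suc (toℕ i) ≡ suc d × toℕ j ≡ 0) →
             Adj G s (vertex i) (vertex j)
  adjacent i j (inj₁ i+1≡j) =
    Adj-unremove G e (subst (λ u → Adj G (s - e) u (vertex j)) (sym vertex-i≡parent)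
                            (proj₁ (parent-spec vertex-j≢a)))
    where
    vertex-j≢a : vertex j ≢ a
    vertex-j≢a eq =
      0≢1+n (trans (sym dist-root) (trans (cong dist (sym eq)) (trans (dist-vertex j) (sym i+1≡j))))
    vertex-i≡parent : vertex i ≡ parent (vertex j)
    vertex-i≡parent = cong ancestor (trans (+-∸-assoc 1 i+1≤d) (cong (λ x → suc (d ∸ x)) i+1≡j))
      where
      i+1≤d : suc (toℕ i) ≤ d
      i+1≤d = subst (_≤ d) (sym i+1≡j) (≤-pred (Finₚ.toℕ<n j))
  adjacent i j (inj₂ (i+1≡d+1 , j≡0)) =
    subst₂ (Adj G s) (sym vertex-i≡b) (sym vertex-j≡a) (e , e∈s , inj₂ refl)
    where
    vertex-i≡b : vertex i ≡ b
    vertex-i≡b = cong ancestor (trans (cong (d ∸_) (suc-injective i+1≡d+1)) (n∸n≡0 d))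
    vertex-j≡a : vertex j ≡ a
    vertex-j≡a = dist≡0⇒≡root (trans (dist-vertex j) j≡0)

  cycle : Cycle G s (suc d)
  cycle = vertex , vertex-injective , 3≤d+1 , adjacent

girth≤count-treeDeletions : ∀ {n m} (G : Graph n m) {g} → IsGirth G g →
  (T? : Decidable (IsSpanningTree G)) → ∀ s → IsUnicyclic G s →
  g ≤ count (λ e → e ∈? s ×-dec T? (s - e))
girth≤count-treeDeletions {zero} G (girthCycle , _) T? s _
  with () ← proj₁ girthCycle (fromℕ< (CycleEdges.0<k G girthCycle))
girth≤count-treeDeletions {suc n} {m} G (_ , girth-minimal) T? s unicyclic@(conn , ∣s∣≡n)
  with e , e∈s , conn-e ← SpanningBreadthFirst.∃-removableEdge G s conn ∣s∣≡n =
  ≤-trans (girth-minimal _ (cycle-mono G (λ _ → ∈⊤) C))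
          (injection⇒≤count (λ e → e ∈? s ×-dec T? (s - e)) cycleEdge
                             (λ eq → Finₚ.toℕ-injective (edgeAt-injective _ _ eq))
                             (λ j → edgeAt-∈ (Finₚ.toℕ<n j) ,
                                    unicyclic-minus-cycleEdge-isSpanningTree G unicyclic C (Finₚ.toℕ<n j)))
  where
  C = CycleThroughEdge.cycle G e∈s conn-e
  open CycleEdges G C
  cycleEdge : Fin _ → Fin m
  cycleEdge j = edgeAt (Finₚ.toℕ<n j)

spanningTree⇒count-∉≤cyc : ∀ {n m} (G : Graph n m) {t} → IsSpanningTree G t →
                           count (λ e → ¬? (e ∈? t)) ≤ cyc G
spanningTree⇒count-∉≤cyc {n} {m} G {t} (conn , _) = m+n≤o⇒m≤o∸n #∉ (begin
  #∉ + n            ≤⟨ +-monoʳ-≤ #∉ (connected⇒n≤suc∣s∣ G conn) ⟩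
  #∉ + suc ∣ t ∣    ≡⟨ +-suc #∉ ∣ t ∣ ⟩
  suc (#∉ + ∣ t ∣)  ≡⟨ cong suc (count-∉+∣s∣ t) ⟩
  suc m             ≡⟨ +-comm 1 m ⟩
  m + 1             ∎)
  where
  open ≤-Reasoning
  #∉ = count (λ e → ¬? (e ∈? t))

lemma3p6 : ∀ {n m} (G : Graph n m) (g : ℕ) →
    IsConnectedGraph G → 1 ≤ cyc G → IsGirth G g →
    (dT : Decidable (IsSpanningTree G)) → (dH : Decidable (IsUnicyclic G)) →
    g * length (filter dH (allSubsets m)) ≤ cyc G * length (filter dT (allSubsets m))
lemma3p6 G g _ _ girth dT dH =
  double-counting dH dT g (cyc G) (girth≤count-treeDeletions G girth dT)
                  (λ _ → spanningTree⇒count-∉≤cyc G)
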